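{- Let $G\in\mathfrak{T}_a$ be a digraph without isolated vertices and with $h_G\ge1$. Assume that for every $H\in\mathfrak{T}_a\cap\mathfrak{D}_r$ with $h_H\in\{h_G,h_G+1\}$ and every $\xi\in\mathcal{H}(G,H)$, $$\big(\xi|_P\in\mathcal{S}(P_\times,H)\text{ for all }P\in\mathcal{P}^h_G\big)\iff\xi\in\mathcal{S}(G,H).$$ Then $G\in\mathfrak{T}^h_{a,h_G}$.
   Context: A digraph $G=(V(G),A(G))$ has finite nonempty vertex set and arc set $A(G)\subseteq V(G)\times V(G)$; $vw$ denotes $(v,w)$; $G^*$ is $G$ with loops removed. A vertex $v$ is isolated if no vertex other than $v$ is adjacent to it (i.e. no arc $vw$ or $wv$ with $w\ne v$). $\mathfrak{D}_r$: reflexive digraphs; $\mathfrak{T}_a$: digraphs $G$ with $G^*$ acyclic. $\mathcal{H}(G,H)$: homomorphisms; $\mathcal{S}(G,H)=\mathcal{H}(G,H)\cap\mathcal{H}(G^*,H^*)$: strict homomorphisms. A path is a sequence $P_0,\dots,P_{\ell(P)}$ of distinct vertices with $P_{i-1}P_i\in A(G)$, of length $\ell(P)$; in $G\in\mathfrak{T}_a$ it is identified with its vertex set $P$, and $\xi|_P$ is the restriction of $\xi$ to $P$. $h_G$: largest path length; $\mathcal{P}^h_G$: the paths of length $h_G$. $P_\times$: digraph with vertex set $P$ and arcs $P_{i-1}P_i$, $1\le i\le\ell(P)$. For $n\in\mathbb{N}_0$, $\mathfrak{T}^h_{a,n}$ is the class of $G\in\mathfrak{T}_a$ of height $n$ in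 which every vertex lies on a path of length $n$. -}

module Defs where

open import Data.Nat using (ℕ; zero; suc; _≤_; _≡ᵇ_)
open import Data.Fin using (Fin; toℕ; inject₁) renaming (suc to fsuc)
open import Data.Fin.Properties using (_≟_)
open import Data.Bool using (Bool; T; _∧_; not)
open import Data.Product using (Σ; ∃; _×_; _,_)
open import Data.Empty using (⊥)
open import Relation.Nullary using (¬_)
open import Relation.Nullary.Decidable using (⌊_⌋)
open import Relation.Binary.PropositionalEquality using (_≡_; _≢_)
open import Function.Definitions using (Injective)

record Digraph : Set where
  constructor mkDigraph
  field
    k   : ℕ
    arc : Fin (suc k) → Fin (suc k) → Bool

open Digraph public

V : Digraph → Set
V G = Fin (suc (k G))

A : (G : Digraph) → V G → V G → Set
A G v w = T (arc G v w)

star : Digraph → Digraph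
star G = mkDigraph (k G) (λ v w → arc G v w ∧ not ⌊ v ≟ w ⌋)

Hom : (G H : Digraph) → (V G → V H) → Set
Hom G H f = ∀ v w → A G v w → A H (f v) (f w)

StrictHom : (G H : Digraph) → (V G → V H) → Set
StrictHom G H f = Hom G H f × Hom (star G) (star H) f

Reflexive : Digraph → Set
Reflexive G = ∀ v → A G v v

data Walk⁺ (G : Digraph) : V G → V G → Set where
  one  : ∀ {u v} → A G u v → Walk⁺ G u v
  cons : ∀ {u v w} → A G u v → Walk⁺ G v w → Walk⁺ G u w

Acyclic : Digraph → Set
Acyclic G = ∀ v → ¬ Walk⁺ G v v

InTa : Digraph → Set
InTa G = Acyclic (star G)

Isolated : (G : Digraph) → V G → Set
Isolated G v = ∀ w → w ≢ v → ¬ A G v w × ¬ A G w v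

record Path (G : Digraph) : Set where
  constructor mkPath
  field
    len  : ℕ
    vert : Fin (suc len) → V G
    inj  : Injective _≡_ _≡_ vert
    arcs : ∀ (i : Fin len) → A G (vert (inject₁ i)) (vert (fsuc i))

open Path public

IsHeight : Digraph → ℕ → Set
IsHeight G h = Σ (Path G) (λ P → len P ≡ h) × (∀ (P : Path G) → len P ≤ h)

Px : ∀ {G} → Path G → Digraph
Px P = mkDigraph (len P) (λ i j → toℕ j ≡ᵇ suc (toℕ i))

restrict : (G H : Digraph) → (V G → V H) → (P : Path G) → V (Px P) → V H
restrict G H ξ P i = ξ (vert P i)

InTh : Digraph → ℕ → Set
InTh G n = InTa G × IsHeight G n
         × (∀ v → Σ (Path G) (λ P → len P ≡ n × ∃ λ i → vert P i ≡ v))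

module Submission where

-- Let G ∈ T_a have height h.  The depth d(u) of a vertex u is the
-- largest length of a path starting at u; it lies in {0,…,h} and, because G* is
-- acyclic, it strictly decreases along every non-loop arc.  So d is a strict
-- homomorphism from G into the reflexive chain C_h (vertices 0,…,h, an arc
-- i → j whenever j ≤ i), which lies in T_a and has height h.
-- Suppose a vertex v lies on no path of length h.  As v is not isolated it has
-- a neighbour c ≠ v; choosing c of extremal depth (a deepest out-neighbour, or
-- failing that a shallowest in-neighbour), the map ξ that agrees with d except
-- ξ(v) = d(c) is still a homomorphism G → C_h.  Every path of length h avoids
-- v, so ξ restricted to it is d restricted to it, which is strict; the
-- hypothesis of the theorem then makes ξ strict on G, which is absurd since
-- the non-loop arc between v and c is collapsed to a loop.

open import Defs
open import Data.Nat using (ℕ; suc; _≤_; _<_; s≤s; _∸_; _≤ᵇ_)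
import Data.Nat.Properties as ℕ
open import Data.Fin using (Fin; toℕ; inject₁; fromℕ<; opposite) renaming (zero to fzero; suc to fsuc)
open import Data.Fin.Properties using (_≟_; any?; all?; toℕ-injective; toℕ-inject₁; toℕ-fromℕ<; opposite-prop; opposite-involutive; injective⇒≤)
open import Data.Vec.Functional using (_∷_)
open import Data.List using (List; filter; allFin)
open import Data.List.Extrema.Nat using (argmax; argmin; argmax-all; argmin-all; f[xs]≤f[argmax]; f[argmin]≤f[xs])
open import Data.List.Relation.Unary.All using (lookup)
open import Data.List.Relation.Unary.All.Properties using (all-filter)
open import Data.List.Membership.Propositional using (_∈_)
open import Data.List.Membership.Propositional.Properties using (∈-filter⁺; ∈-allFin)
open import Data.Bool using (true; false)
open import Data.Sum using (_⊎_; inj₁; inj₂)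
open import Data.Product using (Σ; ∃; _×_; _,_; proj₁; proj₂)
open import Data.Empty using (⊥-elim)
open import Data.Unit using (tt)
open import Relation.Nullary using (¬_; Dec; yes; no)
open import Relation.Nullary.Decidable using (_×-dec_; _→-dec_; map′; T?; ¬?)
open import Relation.Unary using (Pred; Decidable)
open import Relation.Binary.PropositionalEquality using (_≡_; _≢_; refl; sym; trans; cong; subst; subst₂)
open import Function.Bundles using (_⇔_; Equivalence)
open import Function.Definitions using (Injective)
open import Level using (0ℓ)

star-intro : ∀ G {x y} → A G x y → x ≢ y → A (star G) x y
star-intro G {x} {y} a x≢y with x ≟ y
... | yes x≡y = ⊥-elim (x≢y x≡y)
... | no _ with arc G x y
...   | true = tt
...   | false = a

star-elim : ∀ G {x y} → A (star G) x y → A G x y × x ≢ y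
star-elim G {x} {y} s with x ≟ y | arc G x y
... | yes _ | true = ⊥-elim s
... | yes _ | false = ⊥-elim s
... | no x≢y | true = tt , x≢y
... | no _ | false = ⊥-elim s

star-irreflexive : ∀ G x → ¬ A (star G) x x
star-irreflexive G x s = proj₂ (star-elim G s) refl

module Extremal {n} {S : Pred (Fin n) 0ℓ} (S? : Decidable S) (weight : Fin n → ℕ) where

  private
    members : List (Fin n)
    members = filter S? (allFin n)

    is-member : ∀ {y} → S y → y ∈ members
    is-member sy = ∈-filter⁺ S? (∈-allFin _) sy

  argmaxOn : ∃ S → Σ (Fin n) λ x → S x × (∀ y → S y → weight y ≤ weight x)
  argmaxOn (w , sw) =
    best , argmax-all weight sw (all-filter S? (allFin n)) ,
    λ y sy → lookup (f[xs]≤f[argmax] w members) (is-member sy)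
    where best = argmax weight w members

  argminOn : ∃ S → Σ (Fin n) λ x → S x × (∀ y → S y → weight x ≤ weight y)
  argminOn (w , sw) =
    best , argmin-all weight sw (all-filter S? (allFin n)) ,
    λ y sy → lookup (f[argmin]≤f[xs] w members) (is-member sy)
    where best = argmin weight w members

PointwiseInvariant : ∀ {m n} → Pred (Fin m → Fin n) 0ℓ → Set
PointwiseInvariant R = ∀ {f g} → (∀ i → f i ≡ g i) → R f → R g

∷-cong : ∀ {m n} {x : Fin n} {f g : Fin m → Fin n} → (∀ i → f i ≡ g i) → ∀ i → (x ∷ f) i ≡ (x ∷ g) i
∷-cong f≗g fzero = refl
∷-cong f≗g (fsuc i) = f≗g i

∃-function? : ∀ m {n} (R : Pred (Fin m → Fin n) 0ℓ) → PointwiseInvariant R → Decidable R → Dec (∃ R)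
∃-function? ℕ.zero R invariant R? with R? (λ ())
... | yes r = yes (_ , r)
... | no ¬r = no λ { (f , r) → ¬r (invariant (λ ()) r) }
∃-function? (suc m) R invariant R?
  with any? (λ x → ∃-function? m (λ g → R (x ∷ g)) (λ f≗g → invariant (∷-cong f≗g)) (λ g → R? (x ∷ g)))
... | yes (x , g , r) = yes (x ∷ g , r)
... | no none = no λ { (f , r) → none (f fzero , (λ i → f (fsuc i)) , invariant (λ { fzero → refl ; (fsuc i) → refl }) r) }

Arcs : ∀ G {m} → (Fin (suc m) → V G) → Set
Arcs G {m} f = ∀ (i : Fin m) → A G (f (inject₁ i)) (f (fsuc i))

IsPath : ∀ G {m} → (Fin (suc m) → V G) → Set
IsPath G f = Injective _≡_ _≡_ f × Arcs G f

toPath : ∀ G {m} {f : Fin (suc m) → V G} → IsPath G f → Path G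
toPath G {m} {f} (f-inj , f-arcs) = mkPath m f f-inj f-arcs

IsPath? : ∀ G {m} (f : Fin (suc m) → V G) → Dec (IsPath G f)
IsPath? G f = map′ (λ inj {x} {y} → inj x y) (λ inj x y → inj)
                (all? λ x → all? λ y → (f x ≟ f y) →-dec (x ≟ y))
              ×-dec all? (λ i → T? (arc G (f (inject₁ i)) (f (fsuc i))))

IsPath-invariant : ∀ G {m} → PointwiseInvariant (IsPath G {m})
IsPath-invariant G f≗g (f-inj , f-arcs) =
  (λ {x} {y} gx≡gy → f-inj (trans (f≗g x) (trans gx≡gy (sym (f≗g y))))) ,
  (λ i → subst₂ (A G) (f≗g _) (f≗g _) (f-arcs i))

∃-path? : ∀ G m (Q : Pred (Fin (suc m) → V G) 0ℓ) → PointwiseInvariant Q → Decidable Q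
  → Dec (Σ (Fin (suc m) → V G) λ f → IsPath G f × Q f)
∃-path? G m Q Q-invariant Q? =
  ∃-function? (suc m) _ (λ f≗g (p , q) → IsPath-invariant G f≗g p , Q-invariant f≗g q)
    (λ f → IsPath? G f ×-dec Q? f)

OnPathOfLength : ∀ G → ℕ → V G → Set
OnPathOfLength G m v = Σ (Path G) (λ P → len P ≡ m × ∃ λ i → vert P i ≡ v)

onPathOfLength? : ∀ G m v → Dec (OnPathOfLength G m v)
onPathOfLength? G m v
  with ∃-path? G m (λ f → ∃ λ i → f i ≡ v) (λ f≗g (i , fi≡v) → i , trans (sym (f≗g i)) fi≡v)
                   (λ f → any? (λ i → f i ≟ v))
... | yes (f , p , i , fi≡v) = yes (toPath G p , refl , i , fi≡v)
... | no none = no λ { (mkPath .m f f-inj f-arcs , refl , i , fi≡v) → none (f , (f-inj , f-arcs) , i , fi≡v) }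

inject₁≢fsuc : ∀ {m} (i : Fin m) → inject₁ i ≢ fsuc i
inject₁≢fsuc i eq = ℕ.<-irrefl (trans (sym (toℕ-inject₁ i)) (cong toℕ eq)) (ℕ.n<1+n (toℕ i))

path-star-arcs : ∀ G {m} {f : Fin (suc m) → V G} → IsPath G f → Arcs (star G) f
path-star-arcs G (f-inj , f-arcs) i = star-intro G (f-arcs i) (λ eq → inject₁≢fsuc i (f-inj eq))

snoc : ∀ {G x y z} → Walk⁺ G x y → A G y z → Walk⁺ G x z
snoc (one a) b = cons a (one b)
snoc (cons a w) b = cons a (snoc w b)

walk-along : ∀ G {m} (f : Fin (suc m) → V G) → Arcs G f
  → ∀ {x} → Walk⁺ G x (f fzero) → ∀ j → Walk⁺ G x (f j)
walk-along G f f-arcs w fzero = w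
walk-along G {suc m} f f-arcs w (fsuc j) =
  walk-along G (λ i → f (fsuc i)) (λ i → f-arcs (fsuc i)) (snoc w (f-arcs fzero)) j

-- In T_a a path can be extended backwards along a non-loop arc x → y into its
-- first vertex y: the new vertex x cannot already lie on the path, since that
-- would close a cycle in G*.

prepend : ∀ G → InTa G → ∀ {x y m} {f : Fin (suc m) → V G}
  → A G x y → x ≢ y → IsPath G f → f fzero ≡ y → IsPath G (x ∷ f)
prepend G acyclic {x} {y} {f = f} a x≢y p@(f-inj , f-arcs) f0≡y = xf-inj , xf-arcs
  where
    x→f0 : A G x (f fzero)
    x→f0 = subst (A G x) (sym f0≡y) a
    x∉f : ∀ j → x ≢ f j
    x∉f j x≡fj = acyclic x (subst (Walk⁺ (star G) x) (sym x≡fj)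
      (walk-along (star G) f (path-star-arcs G p) (one (star-intro G x→f0 (λ eq → x≢y (trans eq f0≡y)))) j))
    xf-inj : Injective _≡_ _≡_ (x ∷ f)
    xf-inj {fzero} {fzero} _ = refl
    xf-inj {fzero} {fsuc j} eq = ⊥-elim (x∉f j eq)
    xf-inj {fsuc i} {fzero} eq = ⊥-elim (x∉f i (sym eq))
    xf-inj {fsuc i} {fsuc j} eq = cong fsuc (f-inj eq)
    xf-arcs : Arcs G (x ∷ f)
    xf-arcs fzero = x→f0
    xf-arcs (fsuc i) = f-arcs i

successor-index : ∀ {n} (i j : Fin (suc n)) → toℕ j ≡ suc (toℕ i)
  → Σ (Fin n) λ i' → inject₁ i' ≡ i × fsuc i' ≡ j
successor-index {suc n} fzero (fsuc fzero) refl = fzero , refl , refl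
successor-index {suc n} (fsuc i) (fsuc j) eq with successor-index i j (ℕ.suc-injective eq)
... | i' , i'≡i , si'≡j = fsuc i' , cong fsuc i'≡i , cong fsuc si'≡j

Px-arc : ∀ {G} (P : Path G) {i j} → A (Px P) i j → A G (vert P i) (vert P j)
Px-arc P {i} {j} a with successor-index i j (ℕ.≡ᵇ⇒≡ (toℕ j) (suc (toℕ i)) a)
... | i' , refl , refl = arcs P i'

Chain : ℕ → Digraph
Chain h = mkDigraph h (λ i j → toℕ j ≤ᵇ toℕ i)

chain-arc : ∀ {h} {i j : Fin (suc h)} → toℕ j ≤ toℕ i → A (Chain h) i j
chain-arc j≤i = ℕ.≤⇒≤ᵇ j≤i

chain-star-arc : ∀ {h} {i j : Fin (suc h)} → toℕ j < toℕ i → A (star (Chain h)) i j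
chain-star-arc {h} j<i = star-intro (Chain h) (chain-arc (ℕ.<⇒≤ j<i)) (λ i≡j → ℕ.<-irrefl (cong toℕ (sym i≡j)) j<i)

chain-walk-decreases : ∀ {h} {i j} → Walk⁺ (star (Chain h)) i j → toℕ j < toℕ i
chain-walk-decreases {h} {i} {j} (one s) with star-elim (Chain h) {i} {j} s
... | a , i≢j = ℕ.≤∧≢⇒< (ℕ.≤ᵇ⇒≤ _ _ a) (λ eq → i≢j (sym (toℕ-injective eq)))
chain-walk-decreases {h} {i} (cons {v = k} s w) with star-elim (Chain h) {i} {k} s
... | a , _ = ℕ.<-≤-trans (chain-walk-decreases w) (ℕ.≤ᵇ⇒≤ _ _ a)

chain-in-Ta : ∀ h → InTa (Chain h)
chain-in-Ta h i w = ℕ.<-irrefl refl (chain-walk-decreases w)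

chain-reflexive : ∀ h → Reflexive (Chain h)
chain-reflexive h i = chain-arc (ℕ.≤-refl {toℕ i})

-- The path h, h-1, …, 0 has length h, and no path is longer since C_h has
-- only h+1 vertices.
chain-height : ∀ h → IsHeight (Chain h) h
chain-height h = (mkPath h opposite opposite-injective descending , refl) ,
                 λ P → ℕ.≤-pred (injective⇒≤ (inj P))
  where
    opposite-injective : Injective _≡_ _≡_ (opposite {suc h})
    opposite-injective {x} {y} eq =
      trans (sym (opposite-involutive x)) (trans (cong opposite eq) (opposite-involutive y))
    descending : Arcs (Chain h) opposite
    descending i = chain-arc (subst₂ _≤_ (sym (opposite-prop (fsuc i)))
      (sym (trans (opposite-prop (inject₁ i)) (cong (h ∸_) (toℕ-inject₁ i))))
      (ℕ.∸-monoʳ-≤ h (ℕ.n≤1+n (toℕ i))))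

module Depth (G : Digraph) (acyclic : InTa G) (h : ℕ) (bounded : ∀ (P : Path G) → len P ≤ h) where

  StartsPath : V G → ℕ → Set
  StartsPath u m = Σ (Fin (suc m) → V G) λ f → IsPath G f × f fzero ≡ u

  startsPath? : ∀ u m → Dec (StartsPath u m)
  startsPath? u m = ∃-path? G m (λ f → f fzero ≡ u) (λ f≗g f0≡u → trans (sym (f≗g fzero)) f0≡u) (λ f → f fzero ≟ u)

  trivial-path : ∀ u → StartsPath u 0
  trivial-path u = (λ _ → u) , ((λ { {fzero} {fzero} _ → refl }) , (λ ())) , refl

  -- Opaque so that type checking never unfolds the exhaustive search.
  opaque
    deepest : ∀ u → Σ (Fin (suc h)) λ d → StartsPath u (toℕ d) × (∀ (d' : Fin (suc h)) → StartsPath u (toℕ d') → toℕ d' ≤ toℕ d)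
    deepest u = Extremal.argmaxOn (λ d → startsPath? u (toℕ d)) toℕ (fzero , trivial-path u)

  depth : V G → Fin (suc h)
  depth u = proj₁ (deepest u)

  depth-attained : ∀ u → StartsPath u (toℕ (depth u))
  depth-attained u = proj₁ (proj₂ (deepest u))

  depth-maximal : ∀ u m → StartsPath u m → m ≤ toℕ (depth u)
  depth-maximal u m p@(_ , isPath , _) =
    subst (_≤ toℕ (depth u)) (toℕ-fromℕ< m<1+h)
      (proj₂ (proj₂ (deepest u)) (fromℕ< m<1+h) (subst (StartsPath u) (sym (toℕ-fromℕ< m<1+h)) p))
    where
      m<1+h : m < suc h
      m<1+h = s≤s (bounded (toPath G isPath))

  depth-strict : ∀ {x y} → A G x y → x ≢ y → toℕ (depth y) < toℕ (depth x)
  depth-strict {x} {y} a x≢y with depth-attained y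
  ... | f , isPath , f0≡y = depth-maximal x _ (x ∷ f , prepend G acyclic a x≢y isPath f0≡y , refl)

  depth-monotone : ∀ {x y} → A G x y → toℕ (depth y) ≤ toℕ (depth x)
  depth-monotone {x} {y} a with x ≟ y
  ... | yes refl = ℕ.≤-refl
  ... | no x≢y = ℕ.<⇒≤ (depth-strict a x≢y)

  record CollapsibleNeighbour (v : V G) : Set where
    field
      c : V G
      c≢v : c ≢ v
      adjacent : A G v c ⊎ A G c v
      out-below : ∀ y → y ≢ v → A G v y → toℕ (depth y) ≤ toℕ (depth c)
      in-above : ∀ x → x ≢ v → A G x v → toℕ (depth c) ≤ toℕ (depth x)

  -- Take a deepest out-neighbour if there is one (in-neighbours are deeper
  -- than v, hence than c), otherwise a shallowest in-neighbour.
  collapsible-neighbour : ∀ v → ¬ Isolated G v → CollapsibleNeighbour v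
  collapsible-neighbour v non-isolated with any? (λ y → ¬? (y ≟ v) ×-dec T? (arc G v y))
  ... | yes out with Extremal.argmaxOn (λ y → ¬? (y ≟ v) ×-dec T? (arc G v y)) (λ u → toℕ (depth u)) out
  ...   | c , (c≢v , v→c) , deepest-out = record
          { c = c ; c≢v = c≢v ; adjacent = inj₁ v→c
          ; out-below = λ y y≢v v→y → deepest-out y (y≢v , v→y)
          ; in-above = λ x x≢v x→v → ℕ.<⇒≤ (ℕ.<-trans (depth-strict v→c (λ eq → c≢v (sym eq))) (depth-strict x→v x≢v)) }
  collapsible-neighbour v non-isolated | no no-out with any? (λ x → ¬? (x ≟ v) ×-dec T? (arc G x v))
  ... | yes inn with Extremal.argminOn (λ x → ¬? (x ≟ v) ×-dec T? (arc G x v)) (λ u → toℕ (depth u)) inn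
  ...   | c , (c≢v , c→v) , shallowest-in = record
          { c = c ; c≢v = c≢v ; adjacent = inj₂ c→v
          ; out-below = λ y y≢v v→y → ⊥-elim (no-out (y , y≢v , v→y))
          ; in-above = λ x x≢v x→v → shallowest-in x (x≢v , x→v) }
  collapsible-neighbour v non-isolated | no no-out | no no-in =
    ⊥-elim (non-isolated (λ w w≢v → (λ v→w → no-out (w , w≢v , v→w)) , (λ w→v → no-in (w , w≢v , w→v))))

  module Collapse {v : V G} (neighbour : CollapsibleNeighbour v) where
    open CollapsibleNeighbour neighbour

    ξ : V G → Fin (suc h)
    ξ u with u ≟ v
    ... | yes _ = depth c
    ... | no _ = depth u

    ξ-at-v : ξ v ≡ depth c
    ξ-at-v with v ≟ v
    ... | yes _ = refl
    ... | no v≢v = ⊥-elim (v≢v refl)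

    ξ-off-v : ∀ u → u ≢ v → ξ u ≡ depth u
    ξ-off-v u u≢v with u ≟ v
    ... | yes u≡v = ⊥-elim (u≢v u≡v)
    ... | no _ = refl

    ξ-descends : ∀ x y → A G x y → toℕ (ξ y) ≤ toℕ (ξ x)
    ξ-descends x y x→y with x ≟ v | y ≟ v
    ... | yes refl | yes refl = ℕ.≤-refl
    ... | yes refl | no y≢v = out-below y y≢v x→y
    ... | no x≢v | yes refl = in-above x x≢v x→y
    ... | no x≢v | no y≢v = depth-monotone x→y

    ξ-hom : Hom G (Chain h) ξ
    ξ-hom x y x→y = chain-arc (ξ-descends x y x→y)

    ξ-strict-on-path : (P : Path G) → (∀ i → vert P i ≢ v) → StrictHom (Px P) (Chain h) (restrict G (Chain h) ξ P)
    ξ-strict-on-path P avoids-v = (λ i j i→j → ξ-hom _ _ (Px-arc P i→j)) , strict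
      where
        strict : Hom (star (Px P)) (star (Chain h)) (restrict G (Chain h) ξ P)
        strict i j s with star-elim (Px P) {i} {j} s
        ... | i→j , i≢j = chain-star-arc
          (subst₂ _<_ (cong toℕ (sym (ξ-off-v _ (avoids-v j)))) (cong toℕ (sym (ξ-off-v _ (avoids-v i))))
            (depth-strict (Px-arc P i→j) (λ eq → i≢j (inj P eq))))

    ξ-not-strict : ¬ Hom (star G) (star (Chain h)) ξ
    ξ-not-strict strict with adjacent
    ... | inj₁ v→c = star-irreflexive (Chain h) (depth c)
          (subst₂ (A (star (Chain h))) ξ-at-v (ξ-off-v c c≢v) (strict v c (star-intro G v→c (λ eq → c≢v (sym eq)))))
    ... | inj₂ c→v = star-irreflexive (Chain h) (depth c)
          (subst₂ (A (star (Chain h))) (ξ-off-v c c≢v) ξ-at-v (strict c v (star-intro G c→v c≢v)))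

proposition2 : (G : Digraph) → InTa G → (∀ v → ¬ Isolated G v)
    → (h : ℕ) → IsHeight G h → 1 ≤ h
    → (∀ (H : Digraph) → InTa H → Reflexive H
    → (hH : ℕ) → IsHeight H hH → (hH ≡ h ⊎ hH ≡ suc h)
    → (ξ : V G → V H) → Hom G H ξ
    → ((∀ (P : Path G) → len P ≡ h → StrictHom (Px P) H (restrict G H ξ P))
    ⇔ StrictHom G H ξ))
    → InTh G h
proposition2 G acyclic non-isolated h height _ criterion = acyclic , height , on-longest-path
  where
    open Depth G acyclic h (proj₂ height)

    on-longest-path : ∀ v → OnPathOfLength G h v
    on-longest-path v with onPathOfLength? G h v
    ... | yes on = on
    ... | no avoids = ⊥-elim (ξ-not-strict (proj₂ (Equivalence.to criterion-for-ξ strict-on-longest)))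
      where
        open Collapse (collapsible-neighbour v (non-isolated v))
        criterion-for-ξ : (∀ (P : Path G) → len P ≡ h → StrictHom (Px P) (Chain h) (restrict G (Chain h) ξ P))
                          ⇔ StrictHom G (Chain h) ξ
        criterion-for-ξ = criterion (Chain h) (chain-in-Ta h) (chain-reflexive h) h (chain-height h) (inj₁ refl) ξ ξ-hom
        strict-on-longest : ∀ (P : Path G) → len P ≡ h → StrictHom (Px P) (Chain h) (restrict G (Chain h) ξ P)
        strict-on-longest P len≡h = ξ-strict-on-path P (λ i eq → avoids (P , len≡h , i , eq))
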